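{- Let $m \geq 3$ be an integer, let $\mathcal{A}$ be a finite set with a strict linear order $<$, and let $\mathcal{B}$ be a weakly $(m-1)$-wise balanced design over $\mathcal{A}$. Then $|\mathcal{B}| \leq \alpha(\Gamma_{\mathcal{B}, m})$, where $\alpha$ denotes the independence number.
   Context: For an integer $r \geq 2$ and a set $\mathcal{A}$ (whose elements are called points), a weakly $r$-wise balanced design over $\mathcal{A}$ is a family $\mathcal{B}$ of subsets of $\mathcal{A}$ (called blocks) such that: (1) any $r$ pairwise distinct points are contained together in at most one block; (2) every point lies in at least one block; (3) every block is non-empty. Given $m \geq 3$, a weakly $(m-1)$-wise balanced design $\mathcal{B}$ over $\mathcal{A}$, and a strict linear order $<$ on $\mathcal{A}$, the graph $\Gamma_{\mathcal{B}, m}$ has as vertices all incidence pairs $(x, B)$ with $B \in \mathcal{B}$ and $x \in B$; two vertices $(x, B_1)$ and $(y, B_2)$ are adjacent iff $x < y$, $B_1 \neq B_2$, and $x \in B_2$. -}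

module Defs where

open import Level using (0ℓ)
open import Data.Nat using (ℕ; _∸_; _≤_)
open import Data.Fin using (Fin)
open import Data.Fin.Subset using (Subset; _∈_)
open import Data.Product using (_×_; _,_; ∃)
open import Data.List using (List; length)
open import Data.List.Membership.Propositional renaming (_∈_ to _∈ₗ_)
open import Data.List.Relation.Unary.All using (All)
open import Data.List.Relation.Unary.Unique.Propositional using (Unique)
open import Relation.Binary.Core using (Rel)
open import Relation.Binary.PropositionalEquality using (_≡_; _≢_)
open import Relation.Nullary using (¬_)

-- A finite family of blocks over the point set Fin n, indexed by Fin k.
-- Injectivity of the indexing (required separately) makes it a *set* of
-- k distinct subsets, so |B| = k.
Family : ℕ → ℕ → Set
Family n k = Fin k → Subset n

record WeaklyBalanced (r n k : ℕ) (B : Family n k) : Set where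
  field
    distinct-blocks : ∀ i j → B i ≡ B j → i ≡ j
    at-most-one : (xs : Fin r → Fin n) → (∀ s t → xs s ≡ xs t → s ≡ t) →
                  ∀ i j → (∀ t → xs t ∈ B i) → (∀ t → xs t ∈ B j) → i ≡ j
    covering : ∀ (x : Fin n) → ∃ λ i → x ∈ B i
    nonempty : ∀ i → ∃ λ (x : Fin n) → x ∈ B i

-- A simple graph on a vertex type V, given by a vertex predicate
-- (which elements of the ambient type are vertices) and an edge relation
-- E; u and v are adjacent iff E u v or E v u.
record Graph (V : Set) : Set₁ where
  field
    IsVertex : V → Set
    E        : V → V → Set

-- Γ_{B,m}: vertices are incidence pairs (x , i) with x ∈ B i;
-- (x , i) ~ (y , j) iff x < y, i ≠ j (equivalently B i ≠ B j, as B is injective),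
-- and x ∈ B j.
Γ : ∀ {n k} (_<_ : Rel (Fin n) 0ℓ) (B : Family n k) → Graph (Fin n × Fin k)
Γ _<_ B = record
  { IsVertex = λ { (x , i) → x ∈ B i }
  ; E = λ { (x , i) (y , j) → (x < y) × (i ≢ j) × (x ∈ B j) }
  }

IsIndependent : ∀ {V} (G : Graph V) → List V → Set
IsIndependent {V} G S =
  Unique S × All (Graph.IsVertex G) S ×
  (∀ {u v : V} → u ∈ₗ S → v ∈ₗ S → ¬ Graph.E G u v)

IsIndependenceNumber : ∀ {V} (G : Graph V) → ℕ → Set
IsIndependenceNumber G a =
  (∃ λ S → IsIndependent G S × length S ≡ a) ×
  (∀ S → IsIndependent G S → length S ≤ a)

{-# OPTIONS --safe #-}
module Submission where

-- Choosing in every block its least point gives one incidence (min B , B) per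
-- block, and these form an independent set: an edge (x , Bᵢ) ~ (y , Bⱼ) would put
-- x ∈ Bⱼ strictly below y = min Bⱼ.

open import Defs
open import Level using (0ℓ)
open import Data.Nat using (ℕ; _∸_; _≤_)
open import Data.Fin using (Fin)
open import Data.Fin.Subset using (Subset; _∈_; Nonempty)
open import Data.Fin.Subset.Properties using (_∈?_)
open import Data.List using (List; map; filter; allFin; length)
open import Data.List.Properties using (length-map; length-tabulate)
open import Data.List.Relation.Unary.All using (tabulate; lookup)
import Data.List.Relation.Unary.All.Properties as All
open import Data.List.Membership.Propositional renaming (_∈_ to _∈ₗ_)
open import Data.List.Membership.Propositional.Properties
  using (∈-map⁻; ∈-allFin; ∈-filter⁺; ∈-filter⁻)
open import Data.List.Relation.Unary.Unique.Propositional.Properties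
  using (allFin⁺; map⁺)
import Data.List.Extrema
open import Data.Product using (_×_; _,_; proj₂)
open import Data.Sum using (inj₁; inj₂)
open import Relation.Binary.Core using (Rel)
open import Relation.Binary.Bundles using (StrictTotalOrder; DecTotalOrder)
open import Relation.Binary.Structures using (IsStrictTotalOrder)
import Relation.Binary.Properties.StrictTotalOrder as StrictTotalOrderProperties
open import Relation.Binary.PropositionalEquality using (_≡_; refl; sym; subst; trans)
open import Relation.Nullary using (¬_)
open import Function using (id)

module Minimum {n : ℕ} {_<_ : Rel (Fin n) 0ℓ} (sto : IsStrictTotalOrder _≡_ _<_) where

  private
    strictTotalOrder : StrictTotalOrder 0ℓ 0ℓ 0ℓ
    strictTotalOrder = record { isStrictTotalOrder = sto }

    open StrictTotalOrder strictTotalOrder using (irrefl; asym)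
    open DecTotalOrder (StrictTotalOrderProperties.decTotalOrder strictTotalOrder)
      using (totalOrder) renaming (_≤_ to _≼_)
    open Data.List.Extrema totalOrder using (min; min≤xs; argmin-sel)

    ≼⇒≯ : ∀ {x y} → x ≼ y → ¬ y < x
    ≼⇒≯ (inj₁ x<y) = asym x<y
    ≼⇒≯ (inj₂ refl) = irrefl refl

    elements : Subset n → List (Fin n)
    elements P = filter (_∈? P) (allFin n)

  minimum : (P : Subset n) → Nonempty P → Fin n
  minimum P (x , _) = min x (elements P)

  minimum∈ : (P : Subset n) (ne : Nonempty P) → minimum P ne ∈ P
  minimum∈ P (x , x∈P) with argmin-sel id x (elements P)
  ... | inj₁ min≡x = subst (_∈ P) (sym min≡x) x∈P
  ... | inj₂ min∈elements = proj₂ (∈-filter⁻ (_∈? P) {xs = allFin n} min∈elements)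

  minimum-minimal : (P : Subset n) (ne : Nonempty P) →
                    ∀ {y} → y ∈ P → ¬ y < minimum P ne
  minimum-minimal P (x , _) y∈P =
    ≼⇒≯ (lookup (min≤xs x (elements P)) (∈-filter⁺ (_∈? P) (∈-allFin _) y∈P))

module BlockMinima {n k : ℕ} {_<_ : Rel (Fin n) 0ℓ} (sto : IsStrictTotalOrder _≡_ _<_)
                   (B : Family n k) (nonempty : ∀ i → Nonempty (B i)) where

  open Minimum sto

  minimum-incidence : Fin k → Fin n × Fin k
  minimum-incidence i = minimum (B i) (nonempty i) , i

  block-minima : List (Fin n × Fin k)
  block-minima = map minimum-incidence (allFin k)

  length-block-minima : length block-minima ≡ k
  length-block-minima =
    trans (length-map minimum-incidence (allFin k)) (length-tabulate id)

  minimum-incidence-injective : ∀ {i j} → minimum-incidence i ≡ minimum-incidence j → i ≡ j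
  minimum-incidence-injective refl = refl

  block-minima-non-adjacent : ∀ {u v} → u ∈ₗ block-minima → v ∈ₗ block-minima →
                              ¬ Graph.E (Γ _<_ B) u v
  block-minima-non-adjacent u∈ v∈ edge
    with ∈-map⁻ minimum-incidence u∈ | ∈-map⁻ minimum-incidence v∈
  block-minima-non-adjacent _ _ (xᵢ<xⱼ , _ , xᵢ∈Bⱼ) | i , _ , refl | j , _ , refl =
    minimum-minimal (B j) (nonempty j) xᵢ∈Bⱼ xᵢ<xⱼ

  block-minima-independent : IsIndependent (Γ _<_ B) block-minima
  block-minima-independent =
      map⁺ minimum-incidence-injective (allFin⁺ k)
    , All.map⁺ (tabulate λ {i} _ → minimum∈ (B i) (nonempty i))
    , block-minima-non-adjacent

theorem2p6 : (m n k : ℕ) → 3 ≤ m →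
    (_<_ : Rel (Fin n) 0ℓ) → IsStrictTotalOrder _≡_ _<_ →
    (B : Family n k) → WeaklyBalanced (m ∸ 1) n k B →
    (α : ℕ) → IsIndependenceNumber (Γ _<_ B) α → k ≤ α
theorem2p6 _ _ _ _ _<_ sto B design α (_ , maximal) =
  subst (_≤ α) length-block-minima (maximal block-minima block-minima-independent)
  where open BlockMinima sto B (WeaklyBalanced.nonempty design)
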